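{- Let $Q$ be a period $2$ sink-type quiver on $N$ nodes with matrix $B(1)$, and let $B(2)=\mu_1B(1)$. Then the quiver with matrix $B(1)+\rho^{ -1}B(2)\rho$ has period $1$, i.e. $C=B(1)+\rho^{ -1}B(2)\rho$ satisfies $\mu_1C=\rho C\rho^{ -1}$.
   Context: A quiver on nodes $1,\dots,N$ (no loops, no $2$-cycles) is identified with the skew-symmetric integer matrix $B=(b_{ij})$, $b_{ij}$ = number of arrows $i\to j$ minus number $j\to i$; sums of quivers correspond to sums of matrices. Mutation at $k$: $\mu_kB=\tilde B$ with $\tilde b_{ij}=-b_{ij}$ if $i=k$ or $j=k$, else $\tilde b_{ij}=b_{ij}+\frac12(|b_{ik}|b_{kj}+b_{ik}|b_{kj}|)$. $\rho$: permutation matrix with $\rho_{i+1,i}=1$ ($1\le i\le N-1$), $\rho_{1,N}=1$, others $0$. Node $i$ is a sink if $b_{ij}\le0$ for all $j$. A quiver is period $2$ sink-type if $\mu_2\mu_1B(1)=\rho^2B(1)\rho^{ -2}$, node $1$ is a sink of $B(1)$ and node $2$ is a sink of $B(2)=\mu_1B(1)$. -}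

module Defs where

open import Data.Nat as ℕ using (ℕ; suc; _≡ᵇ_; _∸_)
open import Data.Integer using (ℤ; 0ℤ; 1ℤ; _+_; _*_; -_; _≤_; _/ℕ_)
open import Data.Integer.Base using (∣_∣)
open import Data.Bool using (if_then_else_; _∨_; _∧_)
open import Data.Fin as Fin using (Fin; toℕ)
open import Data.Vec.Functional using (foldr)
open import Relation.Binary.PropositionalEquality using (_≡_)

-- Integer N×N matrices; node k (1-based in the paper) is the Fin index k-1.
Mat : ℕ → Set
Mat N = Fin N → Fin N → ℤ

abs : ℤ → ℤ
abs x = Data.Integer.+ ∣ x ∣

Σᶠ : ∀ {N} → (Fin N → ℤ) → ℤ
Σᶠ f = foldr _+_ 0ℤ f

_⊗_ : ∀ {N} → Mat N → Mat N → Mat N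
(A ⊗ B) i j = Σᶠ (λ k → A i k * B k j)

infixl 7 _⊗_

_≋_ : ∀ {N} → Mat N → Mat N → Set
A ≋ B = ∀ i j → A i j ≡ B i j

_⊕_ : ∀ {N} → Mat N → Mat N → Mat N
(A ⊕ B) i j = A i j + B i j

SkewSym : ∀ {N} → Mat N → Set
SkewSym B = ∀ i j → B i j ≡ - B j i

-- The cyclic permutation matrix ρ: ρ_{i+1,i} = 1 (1 ≤ i ≤ N-1), ρ_{1,N} = 1,
-- all other entries 0.  In 0-based indices: ρ i j = 1 iff i = j+1, or i = 0 and j = N-1.
ρ : ∀ {N} → Mat N
ρ {N} i j =
  if (toℕ i ≡ᵇ suc (toℕ j)) ∨ ((toℕ i ≡ᵇ 0) ∧ (toℕ j ≡ᵇ (N ∸ 1)))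
  then 1ℤ else 0ℤ

ρ⁻¹ : ∀ {N} → Mat N
ρ⁻¹ i j = ρ j i

μ : ∀ {N} → Fin N → Mat N → Mat N
μ k B i j =
  if (toℕ i ≡ᵇ toℕ k) ∨ (toℕ j ≡ᵇ toℕ k)
  then - B i j
  else B i j + ((abs (B i k) * B k j + B i k * abs (B k j)) /ℕ 2)

IsSink : ∀ {N} → Mat N → Fin N → Set
IsSink B i = ∀ j → B i j ≤ 0ℤ

node1 : ∀ {n} → Fin (suc (suc n))
node1 = Fin.zero

node2 : ∀ {n} → Fin (suc (suc n))
node2 = Fin.suc Fin.zero

Period2SinkType : ∀ {n} → Mat (suc (suc n)) → Set
Period2SinkType B =
  SkewSym B
  × (μ node2 (μ node1 B) ≋ ((ρ ⊗ ρ) ⊗ B ⊗ (ρ⁻¹ ⊗ ρ⁻¹)))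
  × IsSink B node1
  × IsSink (μ node1 B) node2
  where open import Data.Product using (_×_)

Period1 : ∀ {n} → Mat (suc (suc n)) → Set
Period1 C = μ node1 C ≋ (ρ ⊗ C ⊗ ρ⁻¹)

-- At a sink k of a skew-symmetric matrix the correction term of the mutation rule
-- vanishes (b_ik ≥ 0 ≥ b_kj), so μ_k merely negates row and column k.  Conjugation
-- by ρ reindexes cyclically: (ρ M ρ⁻¹)_ij = M_{i-1,j-1} and (ρ⁻¹ M ρ)_ij = M_{i+1,j+1}.
-- Hence C = B(1) + ρ⁻¹B(2)ρ is skew-symmetric with node 1 a sink, and μ₁ negates
-- row/column 1 of both summands.  On B(1) this gives B(2); on the shifted B(2) it
-- negates row/column 2 of B(2), i.e. applies μ₂, which by the period 2 hypothesis
-- yields ρ²B(1)ρ⁻² shifted back once.  Thus μ₁C = B(2) + ρB(1)ρ⁻¹ = ρCρ⁻¹.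
module Submission where

open import Defs
open import Data.Nat as ℕ using (ℕ; suc; _≡ᵇ_)
import Data.Nat.Properties as ℕ
open import Data.Integer as ℤ using (ℤ; 0ℤ; 1ℤ; _+_; _*_; -_; _≤_; +_)
import Data.Integer.Properties as ℤ
open import Data.Bool using (Bool; true; false; if_then_else_; _∨_)
open import Data.Bool.Properties using (∨-comm)
open import Data.Fin as Fin using (Fin; toℕ; fromℕ; inject₁; lower₁; punchIn)
import Data.Fin.Properties as Fin
open import Data.Vec.Functional using (removeAt)
open import Data.Product using (_×_; _,_; proj₁; proj₂)
open import Function using (_∘_)
open import Relation.Nullary using (yes; no; contradiction)
open import Relation.Nullary.Decidable using (dec-true; dec-false)
open import Relation.Binary.PropositionalEquality
open import Algebra.Properties.CommutativeMonoid.Sum ℤ.+-0-commutativeMonoid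
  using (sum-cong-≗; sum-replicate-zero; sum-remove)

private
  variable
    N : ℕ

IsUnitAt : (Fin N → ℤ) → Fin N → Set
IsUnitAt u k₀ = u k₀ ≡ 1ℤ × (∀ k → k ≢ k₀ → u k ≡ 0ℤ)

IsUnitAt-resp : ∀ {u v : Fin N → ℤ} {k₀} →
                (∀ k → u k ≡ v k) → IsUnitAt v k₀ → IsUnitAt u k₀
IsUnitAt-resp u≗v (v₀ , v-off) = trans (u≗v _) v₀ , λ k k≢k₀ → trans (u≗v k) (v-off k k≢k₀)

Σᶠ-unitˡ : ∀ {n} {u : Fin (suc n) → ℤ} {k₀} → IsUnitAt u k₀ →
           ∀ (g : Fin (suc n) → ℤ) → Σᶠ (λ k → u k * g k) ≡ g k₀
Σᶠ-unitˡ {n} {u} {k₀} (u₀ , u-off) g = begin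
  Σᶠ ug                             ≡⟨ sum-remove {i = k₀} ug ⟩
  u k₀ * g k₀ + Σᶠ (removeAt ug k₀) ≡⟨ cong₂ _+_ (cong (_* g k₀) u₀) rest≡0 ⟩
  1ℤ * g k₀ + 0ℤ                    ≡⟨ ℤ.+-identityʳ (1ℤ * g k₀) ⟩
  1ℤ * g k₀                         ≡⟨ ℤ.*-identityˡ (g k₀) ⟩
  g k₀                              ∎
  where
  open ≡-Reasoning
  ug : Fin (suc n) → ℤ
  ug k = u k * g k
  off≡0 : ∀ k → removeAt ug k₀ k ≡ 0ℤ
  off≡0 k = trans (cong (_* g (punchIn k₀ k)) (u-off _ (Fin.punchInᵢ≢i k₀ k)))
                  (ℤ.*-zeroˡ (g (punchIn k₀ k)))
  rest≡0 : Σᶠ (removeAt ug k₀) ≡ 0ℤ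
  rest≡0 = trans (sum-cong-≗ off≡0) (sum-replicate-zero n)

Σᶠ-unitʳ : ∀ {n} {u : Fin (suc n) → ℤ} {k₀} → IsUnitAt u k₀ →
           ∀ (g : Fin (suc n) → ℤ) → Σᶠ (λ k → g k * u k) ≡ g k₀
Σᶠ-unitʳ {u = u} unit g = trans (sum-cong-≗ (λ k → ℤ.*-comm (g k) (u k))) (Σᶠ-unitˡ unit g)

RowsUnitAt : Mat N → (Fin N → Fin N) → Set
RowsUnitAt P σ = ∀ i → IsUnitAt (P i) (σ i)

ColsUnitAt : Mat N → (Fin N → Fin N) → Set
ColsUnitAt P σ = ∀ j → IsUnitAt (λ k → P k j) (σ j)

⊗-rowsUnitAt : ∀ {n} {P : Mat (suc n)} {σ} → RowsUnitAt P σ →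
               ∀ M i j → (P ⊗ M) i j ≡ M (σ i) j
⊗-rowsUnitAt rows M i j = Σᶠ-unitˡ (rows i) (λ k → M k j)

⊗-colsUnitAt : ∀ {n} {P : Mat (suc n)} {σ} → ColsUnitAt P σ →
               ∀ M i j → (M ⊗ P) i j ≡ M i (σ j)
⊗-colsUnitAt cols M i j = Σᶠ-unitʳ (cols j) (M i)

RowsUnitAt-⊗ : ∀ {n} {P Q : Mat (suc n)} {σ τ} →
               RowsUnitAt P σ → RowsUnitAt Q τ → RowsUnitAt (P ⊗ Q) (τ ∘ σ)
RowsUnitAt-⊗ {Q = Q} P-rows Q-rows i = IsUnitAt-resp (⊗-rowsUnitAt P-rows Q i) (Q-rows _)

ColsUnitAt-⊗ : ∀ {n} {P Q : Mat (suc n)} {σ τ} →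
               ColsUnitAt P σ → ColsUnitAt Q τ → ColsUnitAt (P ⊗ Q) (σ ∘ τ)
ColsUnitAt-⊗ {P = P} P-cols Q-cols j =
  IsUnitAt-resp (λ k → ⊗-colsUnitAt Q-cols P k j) (P-cols _)

RowsUnitAt⇒ColsUnitAt : ∀ {P : Mat N} {σ τ} → (∀ j → σ (τ j) ≡ j) → (∀ i → τ (σ i) ≡ i) →
                        RowsUnitAt P σ → ColsUnitAt P τ
RowsUnitAt⇒ColsUnitAt {P = P} {σ} {τ} στ τσ rows j = one , off
  where
  one : P (τ j) j ≡ 1ℤ
  one = subst (λ x → P (τ j) x ≡ 1ℤ) (στ j) (proj₁ (rows (τ j)))
  off : ∀ k → k ≢ τ j → P k j ≡ 0ℤ
  off k k≢τj = proj₂ (rows k) j (λ j≡σk → k≢τj (trans (sym (τσ k)) (cong τ (sym j≡σk))))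

ρ-entry : Bool → ℤ
ρ-entry b = if b then 1ℤ else 0ℤ

module _ {m : ℕ} where

  cyclicPred : Fin (suc m) → Fin (suc m)
  cyclicPred Fin.zero    = fromℕ m
  cyclicPred (Fin.suc k) = inject₁ k

  cyclicSuc : Fin (suc m) → Fin (suc m)
  cyclicSuc j with m ℕ.≟ toℕ j
  ... | yes _  = Fin.zero
  ... | no m≢j = Fin.suc (lower₁ j m≢j)

  cyclicPred-cyclicSuc : ∀ j → cyclicPred (cyclicSuc j) ≡ j
  cyclicPred-cyclicSuc j with m ℕ.≟ toℕ j
  ... | yes m≡j = Fin.toℕ-injective (trans (Fin.toℕ-fromℕ m) m≡j)
  ... | no m≢j  = Fin.inject₁-lower₁ j m≢j

  cyclicSuc-cyclicPred : ∀ i → cyclicSuc (cyclicPred i) ≡ i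
  cyclicSuc-cyclicPred Fin.zero with m ℕ.≟ toℕ (fromℕ m)
  ... | yes _  = refl
  ... | no m≢m = contradiction (sym (Fin.toℕ-fromℕ m)) m≢m
  cyclicSuc-cyclicPred (Fin.suc k) with m ℕ.≟ toℕ (inject₁ k)
  ... | yes m≡k = contradiction (trans m≡k (Fin.toℕ-inject₁ k)) (ℕ.<⇒≢ (Fin.toℕ<n k) ∘ sym)
  ... | no m≢k  = cong Fin.suc (Fin.lower₁-inject₁′ k m≢k)

  ρ-rowsUnitAt : RowsUnitAt ρ cyclicPred
  ρ-rowsUnitAt Fin.zero = one , off
    where
    one : ρ Fin.zero (fromℕ m) ≡ 1ℤ
    one = cong ρ-entry (dec-true (toℕ (fromℕ m) ℕ.≟ m) (Fin.toℕ-fromℕ m))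
    off : ∀ k → k ≢ fromℕ m → ρ Fin.zero k ≡ 0ℤ
    off k k≢m = cong ρ-entry (dec-false (toℕ k ℕ.≟ m) (k≢m ∘ toℕ≡m⇒≡fromℕ))
      where
      toℕ≡m⇒≡fromℕ : toℕ k ≡ m → k ≡ fromℕ m
      toℕ≡m⇒≡fromℕ k≡m = Fin.toℕ-injective (trans k≡m (sym (Fin.toℕ-fromℕ m)))
  ρ-rowsUnitAt (Fin.suc i) = one , off
    where
    ρ-suc : ∀ k → ρ (Fin.suc i) k ≡ ρ-entry (toℕ i ≡ᵇ toℕ k)
    ρ-suc k with toℕ i ≡ᵇ toℕ k
    ... | true  = refl
    ... | false = refl
    one : ρ (Fin.suc i) (inject₁ i) ≡ 1ℤ
    one = trans (ρ-suc (inject₁ i))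
                (cong ρ-entry (dec-true (toℕ i ℕ.≟ _) (sym (Fin.toℕ-inject₁ i))))
    off : ∀ k → k ≢ inject₁ i → ρ (Fin.suc i) k ≡ 0ℤ
    off k k≢i = trans (ρ-suc k) (cong ρ-entry (dec-false (toℕ i ℕ.≟ toℕ k) (k≢i ∘ i≡k⇒)))
      where
      i≡k⇒ : toℕ i ≡ toℕ k → k ≡ inject₁ i
      i≡k⇒ i≡k = Fin.toℕ-injective (trans (sym i≡k) (sym (Fin.toℕ-inject₁ i)))

  ρ-colsUnitAt : ColsUnitAt ρ cyclicSuc
  ρ-colsUnitAt = RowsUnitAt⇒ColsUnitAt cyclicPred-cyclicSuc cyclicSuc-cyclicPred ρ-rowsUnitAt

  ρ-conj : ∀ M i j → (ρ ⊗ M ⊗ ρ⁻¹) i j ≡ M (cyclicPred i) (cyclicPred j)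
  ρ-conj M i j =
    trans (⊗-colsUnitAt ρ-rowsUnitAt (ρ ⊗ M) i j) (⊗-rowsUnitAt ρ-rowsUnitAt M i _)

  ρ⁻¹-conj : ∀ M i j → (ρ⁻¹ ⊗ M ⊗ ρ) i j ≡ M (cyclicSuc i) (cyclicSuc j)
  ρ⁻¹-conj M i j =
    trans (⊗-colsUnitAt ρ-colsUnitAt (ρ⁻¹ ⊗ M) i j) (⊗-rowsUnitAt ρ-colsUnitAt M i _)

  ρ²-conj : ∀ M i j → ((ρ ⊗ ρ) ⊗ M ⊗ (ρ⁻¹ ⊗ ρ⁻¹)) i j
                    ≡ M (cyclicPred (cyclicPred i)) (cyclicPred (cyclicPred j))
  ρ²-conj M i j =
    trans (⊗-colsUnitAt ρ²-cols ((ρ ⊗ ρ) ⊗ M) i j) (⊗-rowsUnitAt ρ²-rows M i _)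
    where
    ρ²-rows : RowsUnitAt (ρ ⊗ ρ) (cyclicPred ∘ cyclicPred)
    ρ²-rows = RowsUnitAt-⊗ ρ-rowsUnitAt ρ-rowsUnitAt
    ρ²-cols : ColsUnitAt (ρ⁻¹ ⊗ ρ⁻¹) (cyclicPred ∘ cyclicPred)
    ρ²-cols = ColsUnitAt-⊗ ρ-rowsUnitAt ρ-rowsUnitAt

SkewSym-ρ⁻¹-conj : ∀ {n} {M : Mat (suc n)} → SkewSym M → SkewSym (ρ⁻¹ ⊗ M ⊗ ρ)
SkewSym-ρ⁻¹-conj {M = M} skew i j = begin
  (ρ⁻¹ ⊗ M ⊗ ρ) i j                ≡⟨ ρ⁻¹-conj M i j ⟩
  M (cyclicSuc i) (cyclicSuc j)    ≡⟨ skew _ _ ⟩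
  - M (cyclicSuc j) (cyclicSuc i)  ≡⟨ cong -_ (ρ⁻¹-conj M j i) ⟨
  - (ρ⁻¹ ⊗ M ⊗ ρ) j i              ∎
  where open ≡-Reasoning

IsSink-ρ⁻¹-conj : ∀ {n} {M : Mat (suc n)} {k} →
                  IsSink M (cyclicSuc k) → IsSink (ρ⁻¹ ⊗ M ⊗ ρ) k
IsSink-ρ⁻¹-conj {M = M} {k} sink j = subst (_≤ 0ℤ) (sym (ρ⁻¹-conj M k j)) (sink (cyclicSuc j))

SkewSym-⊕ : ∀ {A B : Mat N} → SkewSym A → SkewSym B → SkewSym (A ⊕ B)
SkewSym-⊕ {A = A} {B} skewA skewB i j = begin
  A i j + B i j      ≡⟨ cong₂ _+_ (skewA i j) (skewB i j) ⟩
  - A j i + - B j i  ≡⟨ ℤ.neg-distrib-+ (A j i) (B j i) ⟨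
  - (A j i + B j i)  ∎
  where open ≡-Reasoning

IsSink-⊕ : ∀ {A B : Mat N} {k} → IsSink A k → IsSink B k → IsSink (A ⊕ B) k
IsSink-⊕ sinkA sinkB j = ℤ.+-mono-≤ (sinkA j) (sinkB j)

negateIf : Bool → ℤ → ℤ
negateIf true  x = - x
negateIf false x = x

negateIf-neg : ∀ b x → negateIf b (- x) ≡ - negateIf b x
negateIf-neg true  x = refl
negateIf-neg false x = refl

negateIf-+ : ∀ b x y → negateIf b (x + y) ≡ negateIf b x + negateIf b y
negateIf-+ true  x y = ℤ.neg-distrib-+ x y
negateIf-+ false x y = refl

incident : Fin N → Fin N → Fin N → Bool
incident k i j = (toℕ i ≡ᵇ toℕ k) ∨ (toℕ j ≡ᵇ toℕ k)

μ-correction-vanishes : ∀ {y z} → 0ℤ ≤ y → z ≤ 0ℤ → abs y * z + y * abs z ≡ 0ℤ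
μ-correction-vanishes {y} {z} 0≤y z≤0 = begin
  abs y * z + y * abs z  ≡⟨ cong₂ (λ a b → a * z + y * b) (ℤ.0≤i⇒+∣i∣≡i 0≤y) abs-z ⟩
  y * z + y * - z        ≡⟨ cong (λ w → y * z + w) (ℤ.neg-distribʳ-* y z) ⟨
  y * z + - (y * z)      ≡⟨ ℤ.+-inverseʳ (y * z) ⟩
  0ℤ                     ∎
  where
  open ≡-Reasoning
  abs-z : abs z ≡ - z
  abs-z = trans (cong +_ (sym (ℤ.∣-i∣≡∣i∣ z))) (ℤ.0≤i⇒+∣i∣≡i (ℤ.neg-mono-≤ z≤0))

μ-sink : ∀ {M : Mat N} {k} → SkewSym M → IsSink M k →
         ∀ i j → μ k M i j ≡ negateIf (incident k i j) (M i j)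
μ-sink {M = M} {k} skew sink i j with incident k i j
... | true  = refl
... | false = trans (cong (λ c → M i j + (c ℤ./ℕ 2)) (μ-correction-vanishes 0≤Mik (sink j)))
                    (ℤ.+-identityʳ (M i j))
  where
  0≤Mik : 0ℤ ≤ M i k
  0≤Mik = subst (0ℤ ≤_) (sym (skew i k)) (ℤ.neg-mono-≤ (sink i))

SkewSym-μ-sink : ∀ {M : Mat N} {k} → SkewSym M → IsSink M k → SkewSym (μ k M)
SkewSym-μ-sink {M = M} {k} skew sink i j = begin
  μ k M i j                            ≡⟨ μ-sink skew sink i j ⟩
  negateIf (incident k i j) (M i j)    ≡⟨ cong (negateIf (incident k i j)) (skew i j) ⟩
  negateIf (incident k i j) (- M j i)  ≡⟨ negateIf-neg (incident k i j) (M j i) ⟩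
  - negateIf (incident k i j) (M j i)  ≡⟨ cong (λ b → - negateIf b (M j i)) (∨-comm (toℕ i ≡ᵇ toℕ k) _) ⟩
  - negateIf (incident k j i) (M j i)  ≡⟨ cong -_ (μ-sink skew sink j i) ⟨
  - μ k M j i                          ∎
  where open ≡-Reasoning

incident-cyclicSuc : ∀ {n} (i j : Fin (suc (suc n))) →
                     incident node1 i j ≡ incident node2 (cyclicSuc i) (cyclicSuc j)
incident-cyclicSuc i j = sym (cong₂ _∨_ (isNode2-cyclicSuc i) (isNode2-cyclicSuc j))
  where
  isNode2-cyclicSuc : ∀ {n} (i : Fin (suc (suc n))) → (toℕ (cyclicSuc i) ≡ᵇ 1) ≡ (toℕ i ≡ᵇ 0)
  isNode2-cyclicSuc Fin.zero = refl
  isNode2-cyclicSuc {n} (Fin.suc k) with suc n ℕ.≟ toℕ (Fin.suc k)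
  ... | yes _ = refl
  ... | no _  = refl

μ₁-cyclicSuc : ∀ {n} {B₁ : Mat (suc (suc n))} → Period2SinkType B₁ → ∀ i j →
               negateIf (incident node1 i j) (μ node1 B₁ (cyclicSuc i) (cyclicSuc j))
               ≡ B₁ (cyclicPred i) (cyclicPred j)
μ₁-cyclicSuc {B₁ = B₁} (skew₁ , period₂ , sink₁ , sink₂) i j = begin
  negateIf (incident node1 i j) (B₂ (s i) (s j))          ≡⟨ cong (λ b → negateIf b (B₂ (s i) (s j)))
                                                                  (incident-cyclicSuc i j) ⟩
  negateIf (incident node2 (s i) (s j)) (B₂ (s i) (s j))  ≡⟨ μ-sink (SkewSym-μ-sink skew₁ sink₁) sink₂
                                                                   (s i) (s j) ⟨
  μ node2 B₂ (s i) (s j)                                  ≡⟨ period₂ (s i) (s j) ⟩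
  ((ρ ⊗ ρ) ⊗ B₁ ⊗ (ρ⁻¹ ⊗ ρ⁻¹)) (s i) (s j)                 ≡⟨ ρ²-conj B₁ (s i) (s j) ⟩
  B₁ (p (p (s i))) (p (p (s j)))                          ≡⟨ cong₂ (λ a b → B₁ (p a) (p b))
                                                                   (cyclicPred-cyclicSuc i)
                                                                   (cyclicPred-cyclicSuc j) ⟩
  B₁ (p i) (p j)                                          ∎
  where
  open ≡-Reasoning
  B₂ = μ node1 B₁
  s = cyclicSuc
  p = cyclicPred

mainTheorem7 : (n : ℕ) (B₁ : Mat (suc (suc n))) →
    Period2SinkType B₁ →
    Period1 (B₁ ⊕ (ρ⁻¹ ⊗ μ node1 B₁ ⊗ ρ))
mainTheorem7 n B₁ period₂@(skew₁ , _ , sink₁ , sink₂) i j = begin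
  μ node1 C i j                                      ≡⟨ μ-sink skewC sinkC i j ⟩
  negateIf e (C i j)                                 ≡⟨ cong (negateIf e) (C-entry i j) ⟩
  negateIf e (B₁ i j + B₂ (s i) (s j))               ≡⟨ negateIf-+ e (B₁ i j) _ ⟩
  negateIf e (B₁ i j) + negateIf e (B₂ (s i) (s j))  ≡⟨ cong₂ _+_ (sym (μ-sink skew₁ sink₁ i j))
                                                                 (μ₁-cyclicSuc period₂ i j) ⟩
  B₂ i j + B₁ (p i) (p j)                            ≡⟨ ℤ.+-comm (B₂ i j) _ ⟩
  B₁ (p i) (p j) + B₂ i j                            ≡⟨ cong₂ (λ a b → B₁ (p i) (p j) + B₂ a b)
                                                              (cyclicSuc-cyclicPred i)
                                                              (cyclicSuc-cyclicPred j) ⟨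
  B₁ (p i) (p j) + B₂ (s (p i)) (s (p j))            ≡⟨ C-entry (p i) (p j) ⟨
  C (p i) (p j)                                      ≡⟨ ρ-conj C i j ⟨
  (ρ ⊗ C ⊗ ρ⁻¹) i j                                  ∎
  where
  open ≡-Reasoning
  B₂ = μ node1 B₁
  C = B₁ ⊕ (ρ⁻¹ ⊗ B₂ ⊗ ρ)
  s = cyclicSuc
  p = cyclicPred
  e = incident node1 i j
  C-entry : ∀ i j → C i j ≡ B₁ i j + B₂ (s i) (s j)
  C-entry i j = cong (_+_ (B₁ i j)) (ρ⁻¹-conj B₂ i j)
  skewC : SkewSym C
  skewC = SkewSym-⊕ skew₁ (SkewSym-ρ⁻¹-conj (SkewSym-μ-sink skew₁ sink₁))
  sinkC : IsSink C node1
  sinkC = IsSink-⊕ {A = B₁} {B = ρ⁻¹ ⊗ B₂ ⊗ ρ} {k = node1} sink₁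
                   (IsSink-ρ⁻¹-conj {M = B₂} {k = node1} sink₂)
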